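{- Let $\mathcal L'=\{R_1>\dots>R_m\}\subsetneq\mathcal L$ be linearly ordered, and let $S$ be a set of triangles such that $Forb_c(S)$ is a semi-free amalgamation class with set of solutions $\mathcal L'$ and such that $S$ contains no triangle of the form $R_iR_jR'$ with $R_i,R_j\in\mathcal L'$ and $R'\in\mathcal L$. Then for any $A,B,C\in Forb_c(S)$ with $B\subseteq A,C$, we have $A\otimes_B C\in Forb_c(S)$.
   Context: $\mathcal L$ is a language of binary relation symbols interpreted as symmetric irreflexive relations; a structure is complete if any two distinct elements $a,b$ are related by exactly one relation, denoted $\mathbf r(a,b)$. A triangle is a complete structure on three points, specified by the multiset of its edge relations ($R_iR_jR'$ is a triangle with edges in $R_i$, $R_j$, $R'$). $Forb_c(S)$ is the class of finite complete structures embedding no triangle of $S$. $Forb_c(S)$ is a semi-free amalgamation class with set of solutions $\mathcal L'$ if it is an amalgamation class and for all $A,B,C\in Forb_c(S)$ with $B$ a common substructure there is $D\in Forb_c(S)$ containing copies of $A$ and $C$ intersecting exactly in $B$ such that every relation between an element of $A\setminus B$ and an element of $C\setminus B$ lies in $\mathcal L'$. For $B\subseteq A,C$, $A\otimes_B C$ is the complete structure on the disjoint union of $A,C$ over $B$ extending both, with $\mathbf r(a,c)=R_i$ for $a\in A\setminus B$, $c\in C\setminus B$, where $i$ is least such that for no $b\in B$ is the triangle with edges $\mathbf r(a,b),\mathbf r(b,c),R_i$ in $S$ ($R_1$ if $B=\emptyset$). -}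

module Defs where

open import Data.Nat using (ℕ)
open import Data.Fin using (Fin; _<_)
open import Data.Bool using (Bool; true; false; _∨_)
open import Data.Product using (Σ; ∃; _×_; _,_)
open import Data.Sum using (_⊎_)
open import Relation.Nullary using (¬_)
open import Relation.Binary.PropositionalEquality using (_≡_; _≢_)
open import Function.Definitions using (Injective)

-- The language L = {0,…,n-1} of binary relation symbols (finite).
-- A set S of triangles is given by a Boolean predicate on triples of
-- relation symbols; a triangle (a multiset of three edge relations)
-- belongs to S if some ordering of it is accepted.
Triangles : ℕ → Set
Triangles n = Fin n → Fin n → Fin n → Bool

InS : ∀ {n} → Triangles n → Fin n → Fin n → Fin n → Bool
InS S x y z = S x y z ∨ S x z y ∨ S y x z ∨ S y z x ∨ S z x y ∨ S z y x

-- A finite complete L-structure: carrier Fin size, r a b is the unique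
-- relation between distinct a b (its value on the diagonal is irrelevant:
-- relations are irreflexive), symmetric.
record Str (n : ℕ) : Set where
  field
    size : ℕ
    r    : Fin size → Fin size → Fin n
    sym  : ∀ a b → r a b ≡ r b a
open Str public

record Emb {n : ℕ} (X Y : Str n) : Set where
  field
    f   : Fin (size X) → Fin (size Y)
    inj : Injective _≡_ _≡_ f
    pres : ∀ a b → a ≢ b → r Y (f a) (f b) ≡ r X a b
open Emb public

Forb : ∀ {n} → Triangles n → Str n → Set
Forb S X = ∀ a b c → a ≢ b → b ≢ c → a ≢ c →
  InS S (r X a b) (r X b c) (r X a c) ≡ false

AmalgamOver : ∀ {n} {A B C D : Str n} → Emb B A → Emb B C → Emb A D → Emb C D → Set
AmalgamOver {B = B} {A} {C} iA iC eA eC =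
  (∀ b → f eA (f iA b) ≡ f eC (f iC b)) ×
  (∀ a c → f eA a ≡ f eC c → ∃ λ b → (a ≡ f iA b) × (c ≡ f iC b))

NotInB : ∀ {n} {B X : Str n} → Emb B X → Fin (size X) → Set
NotInB i x = ∀ b → x ≢ f i b

-- Forb_c(S) is a semi-free amalgamation class with set of solutions
-- L' = image of ℓ.  (This property already implies the amalgamation
-- property; heredity, iso-closure and JEP are automatic for Forb_c(S).)
SemiFree : ∀ {n m} → Triangles n → (Fin m → Fin n) → Set
SemiFree S ℓ = ∀ (A B C : Str _) → Forb S A → Forb S B → Forb S C →
  (iA : Emb B A) (iC : Emb B C) →
  Σ (Str _) λ D → Forb S D × Σ (Emb A D) λ eA → Σ (Emb C D) λ eC →
    AmalgamOver iA iC eA eC ×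
    (∀ a c → NotInB iA a → NotInB iC c → ∃ λ i → r D (f eA a) (f eC c) ≡ ℓ i)

Admissible : ∀ {n m} (S : Triangles n) (ℓ : Fin m → Fin n) {A B C : Str n}
  → Emb B A → Emb B C → Fin (size A) → Fin (size C) → Fin m → Set
Admissible S ℓ {A} {B} {C} iA iC a c i =
  ∀ b → InS S (r A a (f iA b)) (r C (f iC b) c) (ℓ i) ≡ false

IsTensor : ∀ {n m} (S : Triangles n) (ℓ : Fin m → Fin n) {A B C : Str n}
  (iA : Emb B A) (iC : Emb B C) (D : Str n) → Set
IsTensor S ℓ {A} {B} {C} iA iC D =
  Σ (Emb A D) λ eA → Σ (Emb C D) λ eC →
    AmalgamOver iA iC eA eC ×
    (∀ d → (∃ λ a → f eA a ≡ d) ⊎ (∃ λ c → f eC c ≡ d)) ×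
    (∀ a c → NotInB iA a → NotInB iC c →
      ∃ λ i → (r D (f eA a) (f eC c) ≡ ℓ i) ×
              Admissible S ℓ iA iC a c i ×
              (∀ j → j < i → ¬ Admissible S ℓ iA iC a c j))

module Submission where

-- In any amalgam D ∈ Forb_c(S) of A and C over B, the
--    relation between new points a ∈ A∖B and c ∈ C∖B is admissible (no
--    triangle a b c with b ∈ B lies in S).  Semi-freeness supplies such a D
--    whose cross relations lie in L', so some R_i is admissible for every
--    such pair, and hence there is a least admissible one.
--  * Gluing.  A complete structure on the disjoint union X ⊔ Y is given by
--    X, Y and a cross relation t; it avoids S as soon as X and Y do and the
--    two kinds of mixed triangles (two points in X, or two points in Y) do.
--  * The tensor.  A ⊗_B C is A glued to the induced structure on C∖B, with
--    cross relation r(b,c) for a = b ∈ B and the least admissible R_i for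
--    a ∉ B.  Its mixed triangles avoid S: those with two points in B lie in
--    C, those with exactly one point in B are excluded by admissibility,
--    and the remaining ones have two edges in L', which S never contains.

open import Defs
open import Data.Nat using (ℕ; zero; suc; _+_; s≤s)
open import Data.Fin using (Fin; zero; suc; _<_; _↑ˡ_; _↑ʳ_; splitAt)
open import Data.Fin.Properties
  using (any?; all?; suc-injective; ↑ˡ-injective; ↑ʳ-injective;
         splitAt-↑ˡ; splitAt-↑ʳ; splitAt⁻¹-↑ˡ; splitAt⁻¹-↑ʳ)
  renaming (_≟_ to _≟ᶠ_)
open import Data.Bool using (Bool; false; _∨_)
open import Data.Bool.Properties using (∨-commutativeMonoid) renaming (_≟_ to _≟ᵇ_)
open import Data.Vec using ([]; _∷_)
open import Data.Product using (Σ; ∃; _×_; _,_; proj₁)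
open import Data.Sum using (_⊎_; inj₁; inj₂)
open import Data.Empty using (⊥-elim)
open import Relation.Nullary using (¬_; yes; no)
open import Relation.Unary using (Decidable)
open import Relation.Binary.PropositionalEquality
  using (_≡_; _≢_; refl; trans; cong; cong₂) renaming (sym to ≡-sym)
open import Function.Definitions using (Injective)
open import Algebra.Solver.CommutativeMonoid ∨-commutativeMonoid using (prove; var; _⊕_)

cong₃ : ∀ {X Y Z W : Set} (h : X → Y → Z → W) {x x' y y' z z'} →
  x ≡ x' → y ≡ y' → z ≡ z' → h x y z ≡ h x' y' z'
cong₃ h refl refl refl = refl

module _ {n : ℕ} (S : Triangles n) where

  InS-swap₁₂ : ∀ x y z → InS S x y z ≡ InS S y x z
  InS-swap₁₂ x y z =
    prove 6 (s₁ ⊕ s₂ ⊕ s₃ ⊕ s₄ ⊕ s₅ ⊕ s₆) (s₃ ⊕ s₄ ⊕ s₁ ⊕ s₂ ⊕ s₆ ⊕ s₅)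
      (S x y z ∷ S x z y ∷ S y x z ∷ S y z x ∷ S z x y ∷ S z y x ∷ [])
    where
    s₁ = var zero
    s₂ = var (suc zero)
    s₃ = var (suc (suc zero))
    s₄ = var (suc (suc (suc zero)))
    s₅ = var (suc (suc (suc (suc zero))))
    s₆ = var (suc (suc (suc (suc (suc zero)))))

  InS-swap₂₃ : ∀ x y z → InS S x y z ≡ InS S x z y
  InS-swap₂₃ x y z =
    prove 6 (s₁ ⊕ s₂ ⊕ s₃ ⊕ s₄ ⊕ s₅ ⊕ s₆) (s₂ ⊕ s₁ ⊕ s₅ ⊕ s₆ ⊕ s₃ ⊕ s₄)
      (S x y z ∷ S x z y ∷ S y x z ∷ S y z x ∷ S z x y ∷ S z y x ∷ [])
    where
    s₁ = var zero
    s₂ = var (suc zero)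
    s₃ = var (suc (suc zero))
    s₄ = var (suc (suc (suc zero)))
    s₅ = var (suc (suc (suc (suc zero))))
    s₆ = var (suc (suc (suc (suc (suc zero)))))

  Δ : (X : Str n) → (x y z : Fin (size X)) → Bool
  Δ X x y z = InS S (r X x y) (r X y z) (r X x z)

  Δ-swap₁₂ : ∀ X x y z → Δ X x y z ≡ Δ X y x z
  Δ-swap₁₂ X x y z = trans (InS-swap₂₃ (r X x y) (r X y z) (r X x z))
    (cong (λ u → InS S u (r X x z) (r X y z)) (Str.sym X x y))

  Δ-swap₂₃ : ∀ X x y z → Δ X x y z ≡ Δ X x z y
  Δ-swap₂₃ X x y z =
    trans (InS-swap₁₂ _ _ _) (trans (InS-swap₂₃ _ _ _) (trans (InS-swap₁₂ _ _ _)
      (cong (λ u → InS S (r X x z) u (r X x y)) (Str.sym X y z))))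

Least : ∀ {m} → (Fin m → Set) → Fin m → Set
Least P i = P i × (∀ j → j < i → ¬ P j)

least : ∀ {m} {P : Fin m → Set} → Decidable P → ∃ P → ∃ (Least P)
least {suc m} P? w with P? zero
... | yes p₀ = zero , p₀ , λ _ ()
least {suc m} P? (zero , p₀) | no ¬p₀ = ⊥-elim (¬p₀ p₀)
least {suc m} P? (suc w , pw) | no ¬p₀ with least (λ j → P? (suc j)) (w , pw)
... | i , pᵢ , below = suc i , pᵢ , λ { zero _ → ¬p₀ ; (suc j) (s≤s j<i) → below j j<i }

record Enumeration (N : ℕ) (P : Fin N → Set) : Set where
  field
    count  : ℕ
    point  : Fin count → Fin N
    point-injective : Injective _≡_ _≡_ point
    point-∈ : ∀ j → P (point j)
    point-onto : ∀ x → P x → ∃ λ j → point j ≡ x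

enumerate : ∀ {N} {P : Fin N → Set} → Decidable P → Enumeration N P
enumerate {zero} P? = record
  { count = 0 ; point = λ () ; point-injective = λ { {()} } ; point-∈ = λ () ; point-onto = λ () }
enumerate {suc N} {P} P? with enumerate (λ x → P? (suc x)) | P? zero
... | E | no ¬p₀ = record
  { count = count ; point = λ j → suc (point j)
  ; point-injective = λ e → point-injective (suc-injective e) ; point-∈ = point-∈
  ; point-onto = λ { zero p₀ → ⊥-elim (¬p₀ p₀)
                   ; (suc x) px → let (j , e) = point-onto x px in j , cong suc e } }
  where open Enumeration E
... | E | yes p₀ = record
  { count = suc count ; point = point′ ; point-injective = injective′
  ; point-∈ = λ { zero → p₀ ; (suc j) → point-∈ j }
  ; point-onto = λ { zero _ → zero , refl
                   ; (suc x) px → let (j , e) = point-onto x px in suc j , cong suc e } }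
  where
  open Enumeration E
  point′ : Fin (suc count) → Fin (suc N)
  point′ zero = zero
  point′ (suc j) = suc (point j)
  injective′ : Injective _≡_ _≡_ point′
  injective′ {zero} {zero} _ = refl
  injective′ {suc i} {suc j} e = cong suc (point-injective (suc-injective e))

induced : ∀ {n k} (X : Str n) → (Fin k → Fin (size X)) → Str n
induced X g = record { size = _ ; r = λ j j' → r X (g j) (g j') ; sym = λ j j' → Str.sym X (g j) (g j') }

induced-forb : ∀ {n k} (S : Triangles n) (X : Str n) {g : Fin k → Fin (size X)} →
  Injective _≡_ _≡_ g → Forb S X → Forb S (induced X g)
induced-forb S X g-inj fX j j' j'' d₁ d₂ d₃ =
  fX _ _ _ (λ e → d₁ (g-inj e)) (λ e → d₂ (g-inj e)) (λ e → d₃ (g-inj e))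

InB : ∀ {n} {B X : Str n} → Emb B X → Fin (size X) → Set
InB {B = B} i x = ∃ λ b → x ≡ f i b

position : ∀ {n} {B X : Str n} (i : Emb B X) x → InB i x ⊎ NotInB i x
position i x with any? (λ b → x ≟ᶠ f i b)
... | yes p = inj₁ p
... | no ¬p = inj₂ (λ b e → ¬p (b , e))

common-part : ∀ {n} {A B C : Str n} (iA : Emb B A) (iC : Emb B C) {b b'} → b ≢ b' →
  r A (f iA b) (f iA b') ≡ r C (f iC b) (f iC b')
common-part iA iC {b} {b'} ne = trans (pres iA b b' ne) (≡-sym (pres iC b b' ne))

module _ {n m} (S : Triangles n) (ℓ : Fin m → Fin n)
  {A B C : Str n} (iA : Emb B A) (iC : Emb B C) where

  admissible? : ∀ a c → Decidable (Admissible S ℓ iA iC a c)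
  admissible? a c i = all? (λ b → InS S (r A a (f iA b)) (r C (f iC b) c) (ℓ i) ≟ᵇ false)

  -- In an amalgam D ∈ Forb_c(S) of A and C over B, the relation between new
  -- points a and c is admissible: every triangle a b c with b ∈ B is in D.
  amalgam-admissible : ∀ {D} → Forb S D → (eA : Emb A D) (eC : Emb C D) →
    AmalgamOver iA iC eA eC → ∀ a c → NotInB iA a → NotInB iC c →
    ∀ i → r D (f eA a) (f eC c) ≡ ℓ i → Admissible S ℓ iA iC a c i
  amalgam-admissible {D} fD eA eC (glued , meet) a c a∉B c∉B i eq b =
    trans (≡-sym (cong₃ (InS S) edge-ab edge-bc eq))
      (fD (f eA a) (f eA (f iA b)) (f eC c) a≢b b≢c a≢c)
    where
    a≢b : f eA a ≢ f eA (f iA b)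
    a≢b e = a∉B b (inj eA e)
    b≢c : f eA (f iA b) ≢ f eC c
    b≢c e = c∉B b (≡-sym (inj eC (trans (≡-sym (glued b)) e)))
    a≢c : f eA a ≢ f eC c
    a≢c e = let (b' , a≡b' , _) = meet a c e in a∉B b' a≡b'
    edge-ab : r D (f eA a) (f eA (f iA b)) ≡ r A a (f iA b)
    edge-ab = pres eA a (f iA b) (a∉B b)
    edge-bc : r D (f eA (f iA b)) (f eC c) ≡ r C (f iC b) c
    edge-bc = trans (cong (λ u → r D u (f eC c)) (glued b)) (pres eC (f iC b) c (λ e → c∉B b (≡-sym e)))

  -- Semi-freeness guarantees that every pair of new points has an
  -- admissible relation in L', hence a least one.
  least-admissible : SemiFree S ℓ → Forb S A → Forb S B → Forb S C →
    ∀ a c → NotInB iA a → NotInB iC c → ∃ (Least (Admissible S ℓ iA iC a c))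
  least-admissible sf fA fB fC a c a∉B c∉B with sf A B C fA fB fC iA iC
  ... | D , fD , eA , eC , amalgam , solution =
    let (i , eq) = solution a c a∉B c∉B in
    least (admissible? a c) (i , amalgam-admissible fD eA eC amalgam a c a∉B c∉B i eq)

module Glue {n} (X Y : Str n) (t : Fin (size X) → Fin (size Y) → Fin n) where

  rel : Fin (size X) ⊎ Fin (size Y) → Fin (size X) ⊎ Fin (size Y) → Fin n
  rel (inj₁ x) (inj₁ x') = r X x x'
  rel (inj₁ x) (inj₂ y)  = t x y
  rel (inj₂ y) (inj₁ x)  = t x y
  rel (inj₂ y) (inj₂ y') = r Y y y'

  rel-sym : ∀ u v → rel u v ≡ rel v u
  rel-sym (inj₁ x) (inj₁ x') = Str.sym X x x'
  rel-sym (inj₁ x) (inj₂ y)  = refl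
  rel-sym (inj₂ y) (inj₁ x)  = refl
  rel-sym (inj₂ y) (inj₂ y') = Str.sym Y y y'

  glue : Str n
  glue = record
    { size = size X + size Y
    ; r = λ u v → rel (splitAt (size X) u) (splitAt (size X) v)
    ; sym = λ u v → rel-sym (splitAt (size X) u) (splitAt (size X) v) }

  left : Fin (size X) → Fin (size glue)
  left x = x ↑ˡ size Y

  right : Fin (size Y) → Fin (size glue)
  right y = size X ↑ʳ y

  left-injective : Injective _≡_ _≡_ left
  left-injective = ↑ˡ-injective (size Y) _ _

  right-injective : Injective _≡_ _≡_ right
  right-injective = ↑ʳ-injective (size X) _ _

  left≢right : ∀ x y → left x ≢ right y
  left≢right x y e with trans (≡-sym (splitAt-↑ˡ (size X) x (size Y)))
                      (trans (cong (splitAt (size X)) e) (splitAt-↑ʳ (size X) (size Y) y))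
  ... | ()

  view : ∀ u → (∃ λ x → u ≡ left x) ⊎ (∃ λ y → u ≡ right y)
  view u with splitAt (size X) u in eq
  ... | inj₁ x = inj₁ (x , ≡-sym (splitAt⁻¹-↑ˡ eq))
  ... | inj₂ y = inj₂ (y , ≡-sym (splitAt⁻¹-↑ʳ eq))

  r-LL : ∀ x x' → r glue (left x) (left x') ≡ r X x x'
  r-LL x x' = cong₂ rel (splitAt-↑ˡ (size X) x (size Y)) (splitAt-↑ˡ (size X) x' (size Y))

  r-LR : ∀ x y → r glue (left x) (right y) ≡ t x y
  r-LR x y = cong₂ rel (splitAt-↑ˡ (size X) x (size Y)) (splitAt-↑ʳ (size X) (size Y) y)

  r-RR : ∀ y y' → r glue (right y) (right y') ≡ r Y y y'
  r-RR y y' = cong₂ rel (splitAt-↑ʳ (size X) (size Y) y) (splitAt-↑ʳ (size X) (size Y) y')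

  r-RL : ∀ y x → r glue (right y) (left x) ≡ t x y
  r-RL y x = trans (Str.sym glue (right y) (left x)) (r-LR x y)

  leftEmb : Emb X glue
  leftEmb = record { f = left ; inj = left-injective ; pres = λ x x' _ → r-LL x x' }

  module _ (S : Triangles n) where

    MixedX MixedY : Set
    MixedX = ∀ x x' y → x ≢ x' → InS S (r X x x') (t x' y) (t x y) ≡ false
    MixedY = ∀ x y y' → y ≢ y' → InS S (t x y) (r Y y y') (t x y') ≡ false

    private
      ≢L : ∀ {x₁ x₂} → left x₁ ≢ left x₂ → x₁ ≢ x₂
      ≢L ne e = ne (cong left e)

      ≢R : ∀ {y₁ y₂} → right y₁ ≢ right y₂ → y₁ ≢ y₂
      ≢R ne e = ne (cong right e)

      XXY : MixedX → ∀ x x' y → x ≢ x' → Δ S glue (left x) (left x') (right y) ≡ false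
      XXY mX x x' y ne = trans (cong₃ (InS S) (r-LL x x') (r-LR x' y) (r-LR x y)) (mX x x' y ne)

      XYY : MixedY → ∀ x y y' → y ≢ y' → Δ S glue (left x) (right y) (right y') ≡ false
      XYY mY x y y' ne = trans (cong₃ (InS S) (r-LR x y) (r-RR y y') (r-LR x y')) (mY x y y' ne)

    glue-forb : Forb S X → Forb S Y → MixedX → MixedY → Forb S glue
    glue-forb fX fY mX mY u v w u≢v v≢w u≢w with view u | view v | view w
    ... | inj₁ (x , refl) | inj₁ (x' , refl) | inj₁ (x'' , refl) =
      trans (cong₃ (InS S) (r-LL x x') (r-LL x' x'') (r-LL x x''))
        (fX x x' x'' (≢L u≢v) (≢L v≢w) (≢L u≢w))
    ... | inj₁ (x , refl) | inj₁ (x' , refl) | inj₂ (y , refl) = XXY mX x x' y (≢L u≢v)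
    ... | inj₁ (x , refl) | inj₂ (y , refl) | inj₁ (x' , refl) =
      trans (Δ-swap₂₃ S glue _ _ _) (XXY mX x x' y (≢L u≢w))
    ... | inj₂ (y , refl) | inj₁ (x , refl) | inj₁ (x' , refl) =
      trans (Δ-swap₁₂ S glue _ _ _) (trans (Δ-swap₂₃ S glue _ _ _) (XXY mX x x' y (≢L v≢w)))
    ... | inj₁ (x , refl) | inj₂ (y , refl) | inj₂ (y' , refl) = XYY mY x y y' (≢R v≢w)
    ... | inj₂ (y , refl) | inj₁ (x , refl) | inj₂ (y' , refl) =
      trans (Δ-swap₁₂ S glue _ _ _) (XYY mY x y y' (≢R u≢w))
    ... | inj₂ (y , refl) | inj₂ (y' , refl) | inj₁ (x , refl) =
      trans (Δ-swap₂₃ S glue _ _ _) (trans (Δ-swap₁₂ S glue _ _ _) (XYY mY x y y' (≢R u≢v)))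
    ... | inj₂ (y , refl) | inj₂ (y' , refl) | inj₂ (y'' , refl) =
      trans (cong₃ (InS S) (r-RR y y') (r-RR y' y'') (r-RR y y''))
        (fY y y' y'' (≢R u≢v) (≢R v≢w) (≢R u≢w))

module Tensor {n m} (S : Triangles n) (ℓ : Fin m → Fin n) (sf : SemiFree S ℓ)
  {A B C : Str n} (fA : Forb S A) (fB : Forb S B) (fC : Forb S C)
  (iA : Emb B A) (iC : Emb B C) where

  new? : Decidable (NotInB iC)
  new? c with position iC c
  ... | inj₁ (b , e) = no (λ c∉B → c∉B b e)
  ... | inj₂ c∉B = yes c∉B

  open Enumeration (enumerate new?) using ()
    renaming (count to #new; point to newPoint; point-injective to newPoint-injective;
              point-∈ to newPoint-new; point-onto to newPoint-onto)

  C∖B : Str n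
  C∖B = induced C newPoint

  cross-at : ∀ a → InB iA a ⊎ NotInB iA a → Fin #new → Fin n
  cross-at a (inj₁ (b , _)) j = r C (f iC b) (newPoint j)
  cross-at a (inj₂ a∉B) j =
    ℓ (proj₁ (least-admissible S ℓ iA iC sf fA fB fC a (newPoint j) a∉B (newPoint-new j)))

  cross : Fin (size A) → Fin #new → Fin n
  cross a = cross-at a (position iA a)

  cross-B : ∀ b j → cross (f iA b) j ≡ r C (f iC b) (newPoint j)
  cross-B b j with position iA (f iA b)
  ... | inj₁ (b' , e) = cong (λ u → r C (f iC u) (newPoint j)) (≡-sym (inj iA e))
  ... | inj₂ a∉B = ⊥-elim (a∉B b refl)

  cross-new : ∀ a j → NotInB iA a →
    ∃ λ i → cross a j ≡ ℓ i × Least (Admissible S ℓ iA iC a (newPoint j)) i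
  cross-new a j a∉B with position iA a
  ... | inj₁ (b , e) = ⊥-elim (a∉B b e)
  ... | inj₂ a∉B' =
    let (i , least-i) = least-admissible S ℓ iA iC sf fA fB fC a (newPoint j) a∉B' (newPoint-new j)
    in i , refl , least-i

  open Glue A C∖B cross

  tensor : Str n
  tensor = glue

  viewC : ∀ c → InB iC c ⊎ ∃ λ j → c ≡ newPoint j
  viewC c with position iC c
  ... | inj₁ c∈B = inj₁ c∈B
  ... | inj₂ c∉B = let (j , e) = newPoint-onto c c∉B in inj₂ (j , ≡-sym e)

  embedC-at : ∀ {c} → InB iC c ⊎ ∃ (λ j → c ≡ newPoint j) → Fin (size tensor)
  embedC-at (inj₁ (b , _)) = left (f iA b)
  embedC-at (inj₂ (j , _)) = right j

  embedC : Fin (size C) → Fin (size tensor)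
  embedC c = embedC-at (viewC c)

  embedC-B : ∀ b → embedC (f iC b) ≡ left (f iA b)
  embedC-B b with viewC (f iC b)
  ... | inj₁ (b' , e) = cong (λ u → left (f iA u)) (≡-sym (inj iC e))
  ... | inj₂ (j , e) = ⊥-elim (newPoint-new j b (≡-sym e))

  embedC-new : ∀ j → embedC (newPoint j) ≡ right j
  embedC-new j with viewC (newPoint j)
  ... | inj₁ (b , e) = ⊥-elim (newPoint-new j b e)
  ... | inj₂ (j' , e) = cong right (≡-sym (newPoint-injective e))

  embedC-injective : Injective _≡_ _≡_ embedC
  embedC-injective {c} {c'} e with viewC c | viewC c'
  ... | inj₁ (b , refl) | inj₁ (b' , refl) = cong (f iC) (inj iA (left-injective e))
  ... | inj₁ (b , refl) | inj₂ (j , refl)  = ⊥-elim (left≢right _ _ e)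
  ... | inj₂ (j , refl) | inj₁ (b , refl)  = ⊥-elim (left≢right _ _ (≡-sym e))
  ... | inj₂ (j , refl) | inj₂ (j' , refl) = cong newPoint (right-injective e)

  embedC-pres : ∀ c c' → c ≢ c' → r tensor (embedC c) (embedC c') ≡ r C c c'
  embedC-pres c c' c≢c' with viewC c | viewC c'
  ... | inj₁ (b , refl) | inj₁ (b' , refl) =
    trans (r-LL _ _) (common-part iA iC (λ e → c≢c' (cong (f iC) e)))
  ... | inj₁ (b , refl) | inj₂ (j , refl)  = trans (r-LR _ j) (cross-B b j)
  ... | inj₂ (j , refl) | inj₁ (b , refl)  =
    trans (r-RL j _) (trans (cross-B b j) (Str.sym C _ _))
  ... | inj₂ (j , refl) | inj₂ (j' , refl) = r-RR j j'

  embC : Emb C tensor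
  embC = record { f = embedC ; inj = embedC-injective ; pres = embedC-pres }

  amalgam : AmalgamOver iA iC leftEmb embC
  amalgam = (λ b → ≡-sym (embedC-B b)) , meet
    where
    meet : ∀ a c → left a ≡ embedC c → ∃ λ b → (a ≡ f iA b) × (c ≡ f iC b)
    meet a c e with viewC c
    ... | inj₁ (b , refl) = b , left-injective e , refl
    ... | inj₂ (j , refl) = ⊥-elim (left≢right a j e)

  covers : ∀ u → (∃ λ a → left a ≡ u) ⊎ (∃ λ c → embedC c ≡ u)
  covers u with view u
  ... | inj₁ (a , refl) = inj₁ (a , refl)
  ... | inj₂ (j , refl) = inj₂ (newPoint j , embedC-new j)

  least-cross : ∀ a c → NotInB iA a → NotInB iC c →
    ∃ λ i → (r tensor (left a) (embedC c) ≡ ℓ i) × Least (Admissible S ℓ iA iC a c) i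
  least-cross a c a∉B c∉B with viewC c
  ... | inj₁ (b , e) = ⊥-elim (c∉B b e)
  ... | inj₂ (j , refl) =
    let (i , eq , least-i) = cross-new a j a∉B in i , trans (r-LR a j) eq , least-i

  isTensor : IsTensor S ℓ iA iC tensor
  isTensor = leftEmb , embC , amalgam , covers , least-cross

  module _ (twoSolutions : ∀ i j x → InS S (ℓ i) (ℓ j) x ≡ false) where

    private
      B≢new : ∀ b j → f iC b ≢ newPoint j
      B≢new b j e = newPoint-new j b (≡-sym e)

    mixedA-at : ∀ x x' j → x ≢ x' → InB iA x ⊎ NotInB iA x → InB iA x' ⊎ NotInB iA x' →
      InS S (r A x x') (cross x' j) (cross x j) ≡ false
    mixedA-at _ _ j x≢x' (inj₁ (b , refl)) (inj₁ (b' , refl)) =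
      trans (cong₃ (InS S) (common-part iA iC b≢b') (cross-B b' j) (cross-B b j))
        (fC (f iC b) (f iC b') (newPoint j) (λ e → b≢b' (inj iC e)) (B≢new b' j) (B≢new b j))
      where
      b≢b' : b ≢ b'
      b≢b' e = x≢x' (cong (f iA) e)
    mixedA-at _ x' j _ (inj₁ (b , refl)) (inj₂ x'∉B) =
      let (i , eq , admissible , _) = cross-new x' j x'∉B in
      trans (cong₃ (InS S) (Str.sym A _ _) eq (cross-B b j))
        (trans (InS-swap₂₃ S _ _ _) (admissible b))
    mixedA-at x _ j _ (inj₂ x∉B) (inj₁ (b' , refl)) =
      let (i , eq , admissible , _) = cross-new x j x∉B in
      trans (cong₃ (InS S) refl (cross-B b' j) eq) (admissible b')
    mixedA-at x x' j _ (inj₂ x∉B) (inj₂ x'∉B) =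
      let (i , eq , _) = cross-new x j x∉B ; (i' , eq' , _) = cross-new x' j x'∉B in
      trans (cong₃ (InS S) refl eq' eq)
        (trans (InS-swap₁₂ S _ _ _) (trans (InS-swap₂₃ S _ _ _) (twoSolutions i' i _)))

    mixedC∖B-at : ∀ x j j' → j ≢ j' → InB iA x ⊎ NotInB iA x →
      InS S (cross x j) (r C∖B j j') (cross x j') ≡ false
    mixedC∖B-at _ j j' j≢j' (inj₁ (b , refl)) =
      trans (cong₃ (InS S) (cross-B b j) refl (cross-B b j'))
        (fC (f iC b) (newPoint j) (newPoint j')
          (B≢new b j) (λ e → j≢j' (newPoint-injective e)) (B≢new b j'))
    mixedC∖B-at x j j' _ (inj₂ x∉B) =
      let (i , eq , _) = cross-new x j x∉B ; (i' , eq' , _) = cross-new x j' x∉B in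
      trans (cong₃ (InS S) eq refl eq')
        (trans (InS-swap₂₃ S _ _ _) (twoSolutions i i' _))

    tensor-forb : Forb S tensor
    tensor-forb = glue-forb S fA (induced-forb S C newPoint-injective fC)
      (λ x x' j ne → mixedA-at x x' j ne (position iA x) (position iA x'))
      (λ x j j' ne → mixedC∖B-at x j j' ne (position iA x))

-- Lemma 6.4: A ⊗_B C exists and lies in Forb_c(S).
lemma6p4 : ∀ {n m} (S : Triangles n) (ℓ : Fin m → Fin n) →
    Injective _≡_ _≡_ ℓ →
    (∃ λ x → ∀ i → ℓ i ≢ x) →
    SemiFree S ℓ →
    (∀ i j x → InS S (ℓ i) (ℓ j) x ≡ false) →
    ∀ (A B C : Str n) → Forb S A → Forb S B → Forb S C →
    (iA : Emb B A) (iC : Emb B C) →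
    Σ (Str n) λ D → IsTensor S ℓ iA iC D × Forb S D
lemma6p4 S ℓ _ _ sf twoSolutions A B C fA fB fC iA iC =
  tensor , isTensor , tensor-forb twoSolutions
  where open Tensor S ℓ sf fA fB fC iA iC
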